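{- For all integers $n,k\geq 0$, $$B_{n+k}=\sum_{j=0}^{n}\binom{n}{j}A_{k+j,k},\qquad A_{n+k+1,n+1}=\sum_{j=0}^{n}\binom{n}{j}A_{k+j,k}2^{n-j}.$$
   Context: A partition of a finite set is a collection of nonempty, pairwise disjoint subsets (blocks) whose union is the set; a singleton of a partition is a block with exactly one element. $B_n$ denotes the $n$-th Bell number ($B_0=1$). For integers $0\leq k\leq n$, $A_{n,k}$ denotes the number of partitions of $\{1,2,\dots,n+1\}$ whose largest singleton is $k+1$ (i.e. $\{k+1\}$ is a block and no $j>k+1$ forms a singleton block). -}

module Defs where

open import Data.Nat using (ℕ; zero; suc; _+_; _*_; _<_; _<?_)
open import Data.Nat.Combinatorics using (_C_)
open import Data.Bool using (Bool; true; false)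
open import Data.Fin using (Fin; toℕ)
open import Data.Fin.Subset using (Subset; _∈_; Nonempty; ⁅_⁆)
open import Data.Fin.Subset.Properties using (_∈?_)
open import Data.Fin.Properties using (any?; all?)
open import Data.List using (List; []; _∷_; _++_; map; concatMap; length; filter; upTo)
open import Data.Nat.ListAction using (sum)
open import Data.List.Relation.Unary.All using (All) renaming (all? to allL?)
open import Data.List.Relation.Unary.Any using (Any) renaming (any? to anyL?)
open import Data.List.Relation.Unary.AllPairs using (AllPairs; allPairs?)
open import Data.Vec using (Vec; []; _∷_)
open import Data.Vec.Properties using (≡-dec)
import Data.Bool.Properties as BoolP
open import Data.Product using (∃; _×_; _,_)
open import Relation.Nullary using (¬_; Dec; ¬?)
open import Relation.Nullary.Decidable using (_×-dec_; _→-dec_)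
open import Relation.Binary.PropositionalEquality using (_≡_)

allSubsets : (m : ℕ) → List (Subset m)
allSubsets zero = [] ∷ []
allSubsets (suc m) = concatMap (λ p → (true ∷ p) ∷ (false ∷ p) ∷ []) (allSubsets m)

-- all sub-collections (subsequences) of a list; applied to a duplicate-free
-- list, these are exactly its subsets
sublists : ∀ {a} {A : Set a} → List A → List (List A)
sublists [] = [] ∷ []
sublists (x ∷ xs) = let r = sublists xs in map (x ∷_) r ++ r

-- Set partitions of Fin m, a partition being a collection of blocks
-- (given as a sub-collection of allSubsets m, hence without repetition)

Disjoint : ∀ {m} → Subset m → Subset m → Set
Disjoint p q = ∀ x → ¬ (x ∈ p × x ∈ q)

IsPartition : ∀ {m} → List (Subset m) → Set
IsPartition {m} bs =
  All Nonempty bs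
  × AllPairs Disjoint bs
  × (∀ (x : Fin m) → Any (λ b → x ∈ b) bs)

nonempty? : ∀ {m} (p : Subset m) → Dec (Nonempty p)
nonempty? p = any? (λ x → x ∈? p)

disjoint? : ∀ {m} (p q : Subset m) → Dec (Disjoint p q)
disjoint? p q = all? (λ x → ¬? ((x ∈? p) ×-dec (x ∈? q)))

isPartition? : ∀ {m} (bs : List (Subset m)) → Dec (IsPartition bs)
isPartition? bs =
  allL? nonempty? bs ×-dec (allPairs? disjoint? bs ×-dec all? (λ x → anyL? (x ∈?_) bs))

partitions : (m : ℕ) → List (List (Subset m))
partitions m = filter isPartition? (sublists (allSubsets m))

Bell : ℕ → ℕ
Bell m = length (partitions m)

-- The set {1,…,n+1} is modelled by Fin (suc n) with
-- element i+1 represented by i : Fin (suc n); so "largest singleton is k+1"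
-- means: the block ⁅ j ⁆ with toℕ j ≡ k occurs, and no ⁅ j ⁆ with
-- toℕ j > k occurs.

_≟S_ : ∀ {m} (p q : Subset m) → Dec (p ≡ q)
_≟S_ = ≡-dec BoolP._≟_

IsSingletonOf : ∀ {m} → List (Subset m) → Fin m → Set
IsSingletonOf bs j = Any (λ b → b ≡ ⁅ j ⁆) bs

LargestSingleton : ∀ {n} → List (Subset (suc n)) → ℕ → Set
LargestSingleton {n} bs k =
  (∃ λ (j : Fin (suc n)) → toℕ j ≡ k × IsSingletonOf bs j)
  × (∀ (j : Fin (suc n)) → k < toℕ j → ¬ IsSingletonOf bs j)

largestSingleton? : ∀ {n} (bs : List (Subset (suc n))) (k : ℕ) → Dec (LargestSingleton bs k)
largestSingleton? bs k =
  any? (λ j → (toℕ j Data.Nat.≟ k) ×-dec anyL? (λ b → b ≟S ⁅ j ⁆) bs)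
  ×-dec all? (λ j → (k <? toℕ j) →-dec ¬? (anyL? (λ b → b ≟S ⁅ j ⁆) bs))

-- A n k = number of partitions of {1,…,n+1} whose largest singleton is k+1
A : ℕ → ℕ → ℕ
A n k = length (filter (λ bs → largestSingleton? bs k) (partitions (suc n)))

sumTo : ℕ → (ℕ → ℕ) → ℕ
sumTo n f = sum (map f (upTo (suc n)))

-- Let N m c (restrictedBell) count the partitions of {0,…,m-1} with no singleton block {j},
-- j ≥ c, so that Bell m = N m m.  Deleting the block {k} maps the partitions of {0,…,n}
-- whose largest singleton is k bijectively onto those counted by N n k, so A n k = N n k.
-- Splitting according to whether {c} is a block gives N (m+1) (c+1) = N m c + N (m+1) c,
-- and merging all singleton blocks with the point 0 gives N (k+1) 1 = Bell k.  Hence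
-- A′ a b = N (a+b) a = A (a+b) a satisfies A′ (a+1) b = A′ a b + A′ a (b+1) and
-- A′ 1 k = A′ k 0, from which both identities follow by induction on n with Pascal's rule.
module Submission where

open import Defs
open import Data.Nat using (ℕ; zero; suc; _+_; _*_; _∸_; _^_; _≤_; _<_; z≤n; s≤s; _≤?_)
open import Data.Nat.Properties
  using ( ≤-refl; ≤-trans; ≤-antisym; ≤-pred; n≤1+n; n<1+n; <⇒≱; m≤n⇒m<n∨m≡n; m≤m+n
        ; +-suc; +-assoc; +-comm; +-identityʳ; +-∸-assoc
        ; *-identityˡ; *-identityʳ; *-assoc; *-distribʳ-+; *-distribˡ-+
        ; +-commutativeSemigroup )
open import Algebra.Properties.CommutativeSemigroup +-commutativeSemigroup
  using (x∙yz≈y∙xz; interchange)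
open import Data.Nat.Combinatorics using (_C_; nCk+nC[k+1]≡[n+1]C[k+1]; k>n⇒nCk≡0)
open import Data.Nat.ListAction using (sum)
open import Data.Bool.ListAction using (any)
open import Data.Nat.Tactic.RingSolver using (solve-∀)
open import Data.Bool using (Bool; true; false; _∧_; _∨_; not; if_then_else_)
open import Data.Bool.Properties
  using (not-involutive; ∧-zeroʳ; ∨-zeroʳ; ∧-identityʳ; ∨-identityʳ; ∧-assoc; ∧-comm)
  renaming (_≟_ to _≟ᵇ_)
open import Data.Fin using (Fin; zero; suc; toℕ; fromℕ<; punchIn; punchOut)
  renaming (_≟_ to _≟ᶠ_)
open import Data.Fin.Properties
  using (toℕ<n; toℕ-fromℕ<; toℕ-injective; punchInᵢ≢i; punchIn-punchOut; all?)
open import Data.Fin.Subset using (Subset; ⁅_⁆) renaming (⊥ to ∅)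
open import Data.Fin.Subset.Properties using (x∈⁅x⁆; x∈⁅y⁆⇒x≡y)
open import Data.List using (List; []; _∷_; map; concatMap; filter; filterᵇ; length; allFin; applyUpTo)
open import Data.List.Membership.Propositional using (_∈_; find; lose)
open import Data.List.Membership.Propositional.Properties
  using (∈-++⁻; ∈-++⁺ˡ; ∈-++⁺ʳ; ∈-map⁻; ∈-map⁺; ∈-allFin)
open import Data.List.Relation.Unary.Any using (here; there; any?)
import Data.List.Relation.Unary.Any as Any
open import Data.List.Relation.Unary.All using ([]; _∷_)
import Data.List.Relation.Unary.All as All
open import Data.List.Relation.Unary.AllPairs using (AllPairs; []; _∷_)
open import Data.List.Relation.Unary.Unique.Propositional using (Unique)
import Data.List.Relation.Unary.Unique.Propositional.Properties as Unique
open import Data.Product using (∃; _×_; _,_; proj₁; proj₂)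
open import Data.Sum using (_⊎_; inj₁; inj₂)
open import Data.Empty using (⊥; ⊥-elim)
open import Data.Vec using ([]; _∷_; lookup; tabulate; insertAt; removeAt; tail)
open import Data.Vec.Properties
  using ( []=⇒lookup; lookup⇒[]=; insertAt-lookup; insertAt-punchIn; removeAt-insertAt
        ; insertAt-removeAt; lookup∘tabulate; tabulate∘lookup; tabulate-cong )
open import Relation.Nullary using (¬_; Dec; yes; no; does)
open import Relation.Nullary.Decidable using (dec-true; dec-false; _→-dec_)
open import Relation.Unary using (Decidable)
open import Relation.Binary.PropositionalEquality
  using (_≡_; _≢_; refl; sym; trans; cong; cong₂; subst; _≗_; module ≡-Reasoning)

boolToℕ : Bool → ℕ
boolToℕ true = 1
boolToℕ false = 0

count : ∀ {a} {A : Set a} → (A → Bool) → List A → ℕ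
count p [] = 0
count p (x ∷ xs) = boolToℕ (p x) + count p xs

module _ {a} {A : Set a} where

  length-filter≡count : ∀ {ℓ} {P : A → Set ℓ} (P? : Decidable P) (xs : List A) →
    length (filter P? xs) ≡ count (λ x → does (P? x)) xs
  length-filter≡count P? [] = refl
  length-filter≡count P? (x ∷ xs) with does (P? x)
  ... | true = cong suc (length-filter≡count P? xs)
  ... | false = length-filter≡count P? xs

  count-filter : ∀ {ℓ} {P : A → Set ℓ} (P? : Decidable P) (q : A → Bool) (xs : List A) →
    count q (filter P? xs) ≡ count (λ x → does (P? x) ∧ q x) xs
  count-filter P? q [] = refl
  count-filter P? q (x ∷ xs) with does (P? x)
  ... | true = cong (boolToℕ (q x) +_) (count-filter P? q xs)
  ... | false = count-filter P? q xs

  count-cong : {p q : A → Bool} → p ≗ q → (xs : List A) → count p xs ≡ count q xs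
  count-cong p≗q [] = refl
  count-cong p≗q (x ∷ xs) = cong₂ _+_ (cong boolToℕ (p≗q x)) (count-cong p≗q xs)

  count-split : (p q : A → Bool) (xs : List A) →
    count p xs ≡ count (λ x → p x ∧ q x) xs + count (λ x → p x ∧ not (q x)) xs
  count-split p q [] = refl
  count-split p q (x ∷ xs) with p x | q x
  ... | true | true = cong suc (count-split p q xs)
  ... | true | false = trans (cong suc (count-split p q xs)) (sym (+-suc _ _))
  ... | false | _ = count-split p q xs

  count-remove : ∀ (q : A → Bool) {y : A} {ys : List A} → y ∈ ys → ∃ λ ys′ →
    count q ys ≡ boolToℕ (q y) + count q ys′ × (∀ z → z ∈ ys → z ≢ y → z ∈ ys′)
  count-remove q {ys = w ∷ ws} (here refl) =
    ws , refl , λ { z (here refl) z≢w → ⊥-elim (z≢w refl) ; z (there z∈ws) _ → z∈ws }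
  count-remove q {y} {ys = w ∷ ws} (there y∈ws) with count-remove q y∈ws
  ... | ws′ , eq , keep = w ∷ ws′ , eq′ , keep′
    where
    eq′ : boolToℕ (q w) + count q ws ≡ boolToℕ (q y) + (boolToℕ (q w) + count q ws′)
    eq′ rewrite eq = x∙yz≈y∙xz (boolToℕ (q w)) (boolToℕ (q y)) (count q ws′)
    keep′ : ∀ z → z ∈ w ∷ ws → z ≢ y → z ∈ w ∷ ws′
    keep′ z (here z≡w) _ = here z≡w
    keep′ z (there z∈ws) z≢y = there (keep z z∈ws z≢y)

module _ {a b} {A : Set a} {B : Set b} (p : A → Bool) (q : B → Bool) where

  count-≤-injection : (f : A → B) (xs : List A) (ys : List B) → Unique xs →
    (∀ x → x ∈ xs → p x ≡ true → f x ∈ ys × q (f x) ≡ true) →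
    (∀ x y → x ∈ xs → y ∈ xs → p x ≡ true → p y ≡ true → f x ≡ f y → x ≡ y) →
    count p xs ≤ count q ys
  count-≤-injection f [] ys _ _ _ = z≤n
  count-≤-injection f (x ∷ xs) ys (x∉xs ∷ uniq) maps inj with p x in px
  ... | false = count-≤-injection f xs ys uniq (λ y m → maps y (there m))
                  (λ y z m n → inj y z (there m) (there n))
  ... | true with maps x (here refl) px
  ... | fx∈ys , qfx with count-remove q fx∈ys
  ... | ys′ , ys≡ , keep = subst (suc (count p xs) ≤_) (sym ys≡′)
          (s≤s (count-≤-injection f xs ys′ uniq maps′ (λ y z m n → inj y z (there m) (there n))))
    where
    ys≡′ : count q ys ≡ suc (count q ys′)
    ys≡′ = trans ys≡ (cong (λ c → boolToℕ c + count q ys′) qfx)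
    maps′ : ∀ y → y ∈ xs → p y ≡ true → f y ∈ ys′ × q (f y) ≡ true
    maps′ y y∈xs py = keep (f y) (proj₁ (maps y (there y∈xs) py)) fy≢fx , proj₂ (maps y (there y∈xs) py)
      where
      fy≢fx : f y ≢ f x
      fy≢fx fy≡fx = All.lookup x∉xs y∈xs (sym (inj y x (there y∈xs) (here refl) py px fy≡fx))

count-≡-bijection : ∀ {a b} {A : Set a} {B : Set b} (p : A → Bool) (q : B → Bool)
  (f : A → B) (g : B → A) (xs : List A) (ys : List B) → Unique xs → Unique ys →
  (∀ x → x ∈ xs → p x ≡ true → f x ∈ ys × q (f x) ≡ true × g (f x) ≡ x) →
  (∀ y → y ∈ ys → q y ≡ true → g y ∈ xs × p (g y) ≡ true × f (g y) ≡ y) →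
  count p xs ≡ count q ys
count-≡-bijection p q f g xs ys uxs uys f-ok g-ok = ≤-antisym
  (count-≤-injection p q f xs ys uxs (λ x m px → proj₁ (f-ok x m px) , proj₁ (proj₂ (f-ok x m px)))
    (λ x y mx my px py eq → trans (sym (proj₂ (proj₂ (f-ok x mx px))))
                                 (trans (cong g eq) (proj₂ (proj₂ (f-ok y my py))))))
  (count-≤-injection q p g ys xs uys (λ y m qy → proj₁ (g-ok y m qy) , proj₁ (proj₂ (g-ok y m qy)))
    (λ x y mx my qx qy eq → trans (sym (proj₂ (proj₂ (g-ok x mx qx))))
                                 (trans (cong f eq) (proj₂ (proj₂ (g-ok y my qy))))))

module _ {a} {A : Set a} where

  sublists-⊆ : ∀ (xs : List A) {ys y} → ys ∈ sublists xs → y ∈ ys → y ∈ xs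
  sublists-⊆ [] (here refl) ()
  sublists-⊆ (x ∷ xs) ys∈ y∈ys with ∈-++⁻ (map (x ∷_) (sublists xs)) ys∈
  ... | inj₂ ys∈′ = there (sublists-⊆ xs ys∈′ y∈ys)
  ... | inj₁ ys∈′ with ∈-map⁻ (x ∷_) ys∈′
  ... | zs , zs∈ , refl with y∈ys
  ... | here y≡x = here y≡x
  ... | there y∈zs = there (sublists-⊆ xs zs∈ y∈zs)

  sublists-unique : ∀ (xs : List A) → Unique xs → Unique (sublists xs)
  sublists-unique [] _ = [] ∷ []
  sublists-unique (x ∷ xs) (x∉xs ∷ uniq) =
    Unique.++⁺ (Unique.map⁺ (λ { refl → refl }) (sublists-unique xs uniq)) (sublists-unique xs uniq) apart
    where
    apart : ∀ {ys} → ¬ (ys ∈ map (x ∷_) (sublists xs) × ys ∈ sublists xs)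
    apart (ys∈₁ , ys∈₂) with ∈-map⁻ (x ∷_) ys∈₁
    ... | _ , _ , refl = All.lookup x∉xs (sublists-⊆ xs ys∈₂ (here refl)) refl

  sublists-member-unique : ∀ (xs : List A) {ys} → Unique xs → ys ∈ sublists xs → Unique ys
  sublists-member-unique [] _ (here refl) = []
  sublists-member-unique (x ∷ xs) (x∉xs ∷ uniq) ys∈ with ∈-++⁻ (map (x ∷_) (sublists xs)) ys∈
  ... | inj₂ ys∈′ = sublists-member-unique xs uniq ys∈′
  ... | inj₁ ys∈′ with ∈-map⁻ (x ∷_) ys∈′
  ... | zs , zs∈ , refl =
    All.tabulate (λ z∈zs x≡z → All.lookup x∉xs (subst (_∈ xs) (sym x≡z) (sublists-⊆ xs zs∈ z∈zs)) refl)
    ∷ sublists-member-unique xs uniq zs∈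

  filterᵇ∈sublists : ∀ (p : A → Bool) (xs : List A) → filterᵇ p xs ∈ sublists xs
  filterᵇ∈sublists p [] = here refl
  filterᵇ∈sublists p (x ∷ xs) with p x
  ... | true = ∈-++⁺ˡ (∈-map⁺ (x ∷_) (filterᵇ∈sublists p xs))
  ... | false = ∈-++⁺ʳ (map (x ∷_) (sublists xs)) (filterᵇ∈sublists p xs)

  ∈-filterᵇ⁻ : ∀ (p : A → Bool) (xs : List A) {y} → y ∈ filterᵇ p xs → p y ≡ true
  ∈-filterᵇ⁻ p (x ∷ xs) y∈ with p x in px
  ∈-filterᵇ⁻ p (x ∷ xs) (here refl) | true = px
  ∈-filterᵇ⁻ p (x ∷ xs) (there y∈) | true = ∈-filterᵇ⁻ p xs y∈
  ... | false = ∈-filterᵇ⁻ p xs y∈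

  ∈-filterᵇ⁺ : ∀ (p : A → Bool) (xs : List A) {y} → y ∈ xs → p y ≡ true → y ∈ filterᵇ p xs
  ∈-filterᵇ⁺ p (x ∷ xs) (here refl) py rewrite py = here refl
  ∈-filterᵇ⁺ p (x ∷ xs) (there y∈) py with p x
  ... | true = there (∈-filterᵇ⁺ p xs y∈ py)
  ... | false = ∈-filterᵇ⁺ p xs y∈ py

  filterᵇ-cong : ∀ {p q : A → Bool} → p ≗ q → (xs : List A) → filterᵇ p xs ≡ filterᵇ q xs
  filterᵇ-cong p≗q [] = refl
  filterᵇ-cong {p} {q} p≗q (x ∷ xs) rewrite p≗q x with q x
  ... | true = cong (x ∷_) (filterᵇ-cong p≗q xs)
  ... | false = filterᵇ-cong p≗q xs

  filterᵇ≡sublist : ∀ (p : A → Bool) (xs : List A) {ys} → Unique xs → ys ∈ sublists xs →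
    (∀ y → y ∈ xs → p y ≡ true → y ∈ ys) → (∀ y → y ∈ ys → p y ≡ true) → filterᵇ p xs ≡ ys
  filterᵇ≡sublist p [] _ (here refl) _ _ = refl
  filterᵇ≡sublist p (x ∷ xs) (x∉xs ∷ uniq) ys∈ ⊇ ⊆ with ∈-++⁻ (map (x ∷_) (sublists xs)) ys∈
  ... | inj₁ ys∈′ with ∈-map⁻ (x ∷_) ys∈′
  ... | zs , zs∈ , refl rewrite ⊆ x (here refl) =
    cong (x ∷_) (filterᵇ≡sublist p xs uniq zs∈ ⊇′ (λ y y∈zs → ⊆ y (there y∈zs)))
    where
    ⊇′ : ∀ y → y ∈ xs → p y ≡ true → y ∈ zs
    ⊇′ y y∈xs py with ⊇ y (there y∈xs) py
    ... | here refl = ⊥-elim (All.lookup x∉xs y∈xs refl)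
    ... | there y∈zs = y∈zs
  filterᵇ≡sublist p (x ∷ xs) (x∉xs ∷ uniq) ys∈ ⊇ ⊆ | inj₂ ys∈′ with p x in px
  ... | true = ⊥-elim (All.lookup x∉xs (sublists-⊆ xs ys∈′ (⊇ x (here refl) px)) refl)
  ... | false = filterᵇ≡sublist p xs uniq ys∈′ (λ y y∈xs → ⊇ y (there y∈xs)) ⊆

extensions : ∀ {m} → Subset m → List (Subset (suc m))
extensions s = (true ∷ s) ∷ (false ∷ s) ∷ []

∈-extensions⁻ : ∀ {m} (ss : List (Subset m)) {t : Subset (suc m)} → t ∈ concatMap extensions ss →
  ∃ λ b → ∃ λ s → t ≡ b ∷ s × s ∈ ss
∈-extensions⁻ (s ∷ ss) (here refl) = true , s , refl , here refl
∈-extensions⁻ (s ∷ ss) (there (here refl)) = false , s , refl , here refl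
∈-extensions⁻ (s ∷ ss) (there (there t∈)) with ∈-extensions⁻ ss t∈
... | b , s′ , t≡ , s′∈ = b , s′ , t≡ , there s′∈

∈-extensions⁺ : ∀ {m} (ss : List (Subset m)) b {s} → s ∈ ss → (b ∷ s) ∈ concatMap extensions ss
∈-extensions⁺ (_ ∷ ss) true (here refl) = here refl
∈-extensions⁺ (_ ∷ ss) false (here refl) = there (here refl)
∈-extensions⁺ (_ ∷ ss) b (there s∈) = there (there (∈-extensions⁺ ss b s∈))

extensions-unique : ∀ {m} (ss : List (Subset m)) → Unique ss → Unique (concatMap extensions ss)
extensions-unique [] _ = []
extensions-unique (s ∷ ss) (s∉ss ∷ uniq) =
  ((λ ()) ∷ All.tabulate (fresh true)) ∷ All.tabulate (fresh false) ∷ extensions-unique ss uniq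
  where
  fresh : ∀ b {t} → t ∈ concatMap extensions ss → (b ∷ s) ≢ t
  fresh b t∈ eq with ∈-extensions⁻ ss t∈
  ... | _ , _ , refl , s′∈ with eq
  ... | refl = All.lookup s∉ss s′∈ refl

allSubsets-unique : ∀ m → Unique (allSubsets m)
allSubsets-unique zero = [] ∷ []
allSubsets-unique (suc m) = extensions-unique (allSubsets m) (allSubsets-unique m)

allSubsets-complete : ∀ {m} (s : Subset m) → s ∈ allSubsets m
allSubsets-complete [] = here refl
allSubsets-complete {suc m} (b ∷ s) = ∈-extensions⁺ (allSubsets m) b (allSubsets-complete s)

dec-true⁻¹ : ∀ {ℓ} {X : Set ℓ} (x? : Dec X) → does x? ≡ true → X
dec-true⁻¹ (yes x) _ = x

∧-true⁻ : ∀ {a b} → a ∧ b ≡ true → a ≡ true × b ≡ true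
∧-true⁻ {true} {true} _ = refl , refl

∧-true⁺ : ∀ {a b} → a ≡ true → b ≡ true → a ∧ b ≡ true
∧-true⁺ refl refl = refl

≡true-⇔⇒≡ : ∀ {a b : Bool} → (a ≡ true → b ≡ true) → (b ≡ true → a ≡ true) → a ≡ b
≡true-⇔⇒≡ {true} {true} _ _ = refl
≡true-⇔⇒≡ {true} {false} a⇒b _ with a⇒b refl
... | ()
≡true-⇔⇒≡ {false} {true} _ b⇒a with b⇒a refl
... | ()
≡true-⇔⇒≡ {false} {false} _ _ = refl

false≢true : false ≢ true
false≢true ()

memberᵇ : ∀ {m} → List (Subset m) → Subset m → Bool
memberᵇ bs s = does (any? (s ≟S_) bs)

memberᵇ⁺ : ∀ {m} (bs : List (Subset m)) s → s ∈ bs → memberᵇ bs s ≡ true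
memberᵇ⁺ bs s = dec-true (any? (s ≟S_) bs)

memberᵇ⁻ : ∀ {m} (bs : List (Subset m)) s → memberᵇ bs s ≡ true → s ∈ bs
memberᵇ⁻ bs s = dec-true⁻¹ (any? (s ≟S_) bs)

record IsPartitionIndicator {m} (χ : Subset m → Bool) : Set where
  field
    nonempty : ∀ s → χ s ≡ true → ∃ λ x → lookup s x ≡ true
    disjoint : ∀ s t x → χ s ≡ true → χ t ≡ true → lookup s x ≡ true → lookup t x ≡ true → s ≡ t
    covering : ∀ x → ∃ λ s → χ s ≡ true × lookup s x ≡ true

open IsPartitionIndicator

IsPartitionIndicator-cong : ∀ {m} {χ χ′ : Subset m → Bool} → χ ≗ χ′ →
  IsPartitionIndicator χ → IsPartitionIndicator χ′
IsPartitionIndicator-cong χ≗χ′ π = record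
  { nonempty = λ s χ′s → nonempty π s (trans (χ≗χ′ s) χ′s)
  ; disjoint = λ s t x χ′s χ′t → disjoint π s t x (trans (χ≗χ′ s) χ′s) (trans (χ≗χ′ t) χ′t)
  ; covering = λ x → let (s , χs , x∈s) = covering π x in s , trans (sym (χ≗χ′ s)) χs , x∈s }

families : ∀ m → List (List (Subset m))
families m = sublists (allSubsets m)

isPartitionᵇ : ∀ {m} → List (Subset m) → Bool
isPartitionᵇ bs = does (isPartition? bs)

module _ {m : ℕ} where

  AllPairs-Disjoint⇒overlap⇒≡ : ∀ (bs : List (Subset m)) → AllPairs Disjoint bs → ∀ s t x →
    s ∈ bs → t ∈ bs → lookup s x ≡ true → lookup t x ≡ true → s ≡ t
  AllPairs-Disjoint⇒overlap⇒≡ (b ∷ bs) (b# ∷ bs#) s t x (here refl) (here refl) _ _ = refl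
  AllPairs-Disjoint⇒overlap⇒≡ (b ∷ bs) (b# ∷ bs#) s t x (here refl) (there t∈) xs xt =
    ⊥-elim (All.lookup b# t∈ x (lookup⇒[]= x s xs , lookup⇒[]= x t xt))
  AllPairs-Disjoint⇒overlap⇒≡ (b ∷ bs) (b# ∷ bs#) s t x (there s∈) (here refl) xs xt =
    ⊥-elim (All.lookup b# s∈ x (lookup⇒[]= x t xt , lookup⇒[]= x s xs))
  AllPairs-Disjoint⇒overlap⇒≡ (b ∷ bs) (b# ∷ bs#) s t x (there s∈) (there t∈) =
    AllPairs-Disjoint⇒overlap⇒≡ bs bs# s t x s∈ t∈

  overlap⇒≡⇒AllPairs-Disjoint : ∀ (bs : List (Subset m)) → Unique bs →
    (∀ s t x → s ∈ bs → t ∈ bs → lookup s x ≡ true → lookup t x ≡ true → s ≡ t) →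
    AllPairs Disjoint bs
  overlap⇒≡⇒AllPairs-Disjoint [] _ _ = []
  overlap⇒≡⇒AllPairs-Disjoint (b ∷ bs) (b∉bs ∷ uniq) same =
    All.tabulate (λ {t} t∈ x (x∈b , x∈t) →
      All.lookup b∉bs t∈ (same b t x (here refl) (there t∈) ([]=⇒lookup x∈b) ([]=⇒lookup x∈t)))
    ∷ overlap⇒≡⇒AllPairs-Disjoint bs uniq (λ s t x s∈ t∈ → same s t x (there s∈) (there t∈))

  isPartitionᵇ⇒indicator : ∀ (bs : List (Subset m)) → isPartitionᵇ bs ≡ true →
    IsPartitionIndicator (memberᵇ bs)
  isPartitionᵇ⇒indicator bs isP with dec-true⁻¹ (isPartition? bs) isP
  ... | nonempty-bs , disjoint-bs , covering-bs = record
    { nonempty = λ s s∈ → let (x , x∈s) = All.lookup nonempty-bs (memberᵇ⁻ bs s s∈) in x , []=⇒lookup x∈s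
    ; disjoint = λ s t x s∈ t∈ →
        AllPairs-Disjoint⇒overlap⇒≡ bs disjoint-bs s t x (memberᵇ⁻ bs s s∈) (memberᵇ⁻ bs t t∈)
    ; covering = λ x → let (s , s∈ , x∈s) = find (covering-bs x) in s , memberᵇ⁺ bs s s∈ , []=⇒lookup x∈s }

  indicator⇒isPartitionᵇ : ∀ (bs : List (Subset m)) → bs ∈ families m →
    IsPartitionIndicator (memberᵇ bs) → isPartitionᵇ bs ≡ true
  indicator⇒isPartitionᵇ bs bs∈ π = dec-true (isPartition? bs)
    ( All.tabulate (λ {s} s∈ → let (x , x∈s) = nonempty π s (memberᵇ⁺ bs s s∈) in x , lookup⇒[]= x s x∈s)
    , overlap⇒≡⇒AllPairs-Disjoint bs uniq
        (λ s t x s∈ t∈ → disjoint π s t x (memberᵇ⁺ bs s s∈) (memberᵇ⁺ bs t t∈))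
    , λ x → let (s , s∈ , x∈s) = covering π x in lose (memberᵇ⁻ bs s s∈) (lookup⇒[]= x s x∈s) )
    where
    uniq : Unique bs
    uniq = sublists-member-unique (allSubsets m) (allSubsets-unique m) bs∈

  memberᵇ-filterᵇ : ∀ (χ : Subset m → Bool) → memberᵇ (filterᵇ χ (allSubsets m)) ≗ χ
  memberᵇ-filterᵇ χ s with χ s in χs
  ... | true = memberᵇ⁺ _ s (∈-filterᵇ⁺ χ (allSubsets m) (allSubsets-complete s) χs)
  ... | false with memberᵇ (filterᵇ χ (allSubsets m)) s in s∈
  ... | false = refl
  ... | true = trans (sym (∈-filterᵇ⁻ χ (allSubsets m) (memberᵇ⁻ _ s s∈))) χs

  filterᵇ-memberᵇ : ∀ (bs : List (Subset m)) → bs ∈ families m → filterᵇ (memberᵇ bs) (allSubsets m) ≡ bs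
  filterᵇ-memberᵇ bs bs∈ = filterᵇ≡sublist (memberᵇ bs) (allSubsets m) (allSubsets-unique m) bs∈
    (λ s _ s∈ → memberᵇ⁻ bs s s∈) (λ s s∈ → memberᵇ⁺ bs s s∈)

-- A family of subsets of Fin m is recovered from its indicator by filtering allSubsets m,
-- so a bijection between indicators respecting two properties equates the numbers of
-- families having them.
record IndicatorBijection (m m′ : ℕ) : Set₁ where
  field
    P : (Subset m → Bool) → Set
    P′ : (Subset m′ → Bool) → Set
    P-resp : ∀ {χ χ′} → χ ≗ χ′ → P χ → P χ′
    P′-resp : ∀ {χ χ′} → χ ≗ χ′ → P′ χ → P′ χ′
    p : List (Subset m) → Bool
    p′ : List (Subset m′) → Bool
    p⇒P : ∀ bs → bs ∈ families m → p bs ≡ true → P (memberᵇ bs)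
    P⇒p : ∀ bs → bs ∈ families m → P (memberᵇ bs) → p bs ≡ true
    p′⇒P′ : ∀ bs → bs ∈ families m′ → p′ bs ≡ true → P′ (memberᵇ bs)
    P′⇒p′ : ∀ bs → bs ∈ families m′ → P′ (memberᵇ bs) → p′ bs ≡ true
    Φ : (Subset m → Bool) → (Subset m′ → Bool)
    Ψ : (Subset m′ → Bool) → (Subset m → Bool)
    Φ-cong : ∀ {χ χ′} → χ ≗ χ′ → Φ χ ≗ Φ χ′
    Ψ-cong : ∀ {χ χ′} → χ ≗ χ′ → Ψ χ ≗ Ψ χ′
    Φ-preserves : ∀ χ → P χ → P′ (Φ χ)
    Ψ-preserves : ∀ χ → P′ χ → P (Ψ χ)
    Ψ∘Φ : ∀ χ → P χ → Ψ (Φ χ) ≗ χ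
    Φ∘Ψ : ∀ χ → P′ χ → Φ (Ψ χ) ≗ χ

count-transfer : ∀ {m m′} (T : IndicatorBijection m m′) →
  count (IndicatorBijection.p T) (families m) ≡ count (IndicatorBijection.p′ T) (families m′)
count-transfer {m} {m′} T = count-≡-bijection p p′ f g (families m) (families m′)
  (sublists-unique _ (allSubsets-unique m)) (sublists-unique _ (allSubsets-unique m′)) f-ok g-ok
  where
  open IndicatorBijection T
  f : List (Subset m) → List (Subset m′)
  f bs = filterᵇ (Φ (memberᵇ bs)) (allSubsets m′)
  g : List (Subset m′) → List (Subset m)
  g cs = filterᵇ (Ψ (memberᵇ cs)) (allSubsets m)
  f-ok : ∀ bs → bs ∈ families m → p bs ≡ true → f bs ∈ families m′ × p′ (f bs) ≡ true × g (f bs) ≡ bs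
  f-ok bs bs∈ pbs =
    fbs∈ , P′⇒p′ (f bs) fbs∈ (P′-resp (λ s → sym (memberᵇ-filterᵇ (Φ (memberᵇ bs)) s)) (Φ-preserves _ Pbs))
    , trans (filterᵇ-cong (λ s → trans (Ψ-cong (memberᵇ-filterᵇ (Φ (memberᵇ bs))) s) (Ψ∘Φ _ Pbs s)) (allSubsets m))
            (filterᵇ-memberᵇ bs bs∈)
    where
    Pbs : P (memberᵇ bs)
    Pbs = p⇒P bs bs∈ pbs
    fbs∈ : f bs ∈ families m′
    fbs∈ = filterᵇ∈sublists (Φ (memberᵇ bs)) (allSubsets m′)
  g-ok : ∀ cs → cs ∈ families m′ → p′ cs ≡ true → g cs ∈ families m × p (g cs) ≡ true × f (g cs) ≡ cs
  g-ok cs cs∈ pcs =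
    gcs∈ , P⇒p (g cs) gcs∈ (P-resp (λ s → sym (memberᵇ-filterᵇ (Ψ (memberᵇ cs)) s)) (Ψ-preserves _ Pcs))
    , trans (filterᵇ-cong (λ s → trans (Φ-cong (memberᵇ-filterᵇ (Ψ (memberᵇ cs))) s) (Φ∘Ψ _ Pcs s)) (allSubsets m′))
            (filterᵇ-memberᵇ cs cs∈)
    where
    Pcs : P′ (memberᵇ cs)
    Pcs = p′⇒P′ cs cs∈ pcs
    gcs∈ : g cs ∈ families m
    gcs∈ = filterᵇ∈sublists (Ψ (memberᵇ cs)) (allSubsets m)

lookup-⁅⁆⇒≡ : ∀ {m} (i j : Fin m) → lookup ⁅ i ⁆ j ≡ true → i ≡ j
lookup-⁅⁆⇒≡ i j j∈⁅i⁆ = sym (x∈⁅y⁆⇒x≡y i (lookup⇒[]= j ⁅ i ⁆ j∈⁅i⁆))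

lookup-⁅i⁆-i : ∀ {m} (i : Fin m) → lookup ⁅ i ⁆ i ≡ true
lookup-⁅i⁆-i i = []=⇒lookup (x∈⁅x⁆ i)

⁅⁆-injective : ∀ {m} {x y : Fin m} → ⁅ x ⁆ ≡ ⁅ y ⁆ → x ≡ y
⁅⁆-injective {x = x} {y} ⁅x⁆≡⁅y⁆ =
  lookup-⁅⁆⇒≡ x y (subst (λ s → lookup s y ≡ true) (sym ⁅x⁆≡⁅y⁆) (lookup-⁅i⁆-i y))

insertAt-∅ : ∀ {m} (i : Fin (suc m)) → insertAt (∅ {m}) i false ≡ ∅
insertAt-∅ zero = refl
insertAt-∅ {suc m} (suc i) = cong (false ∷_) (insertAt-∅ i)

insertAt-⁅⁆ : ∀ {m} (i : Fin (suc m)) (j : Fin m) → insertAt ⁅ j ⁆ i false ≡ ⁅ punchIn i j ⁆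
insertAt-⁅⁆ zero j = refl
insertAt-⁅⁆ (suc i) zero = cong (true ∷_) (insertAt-∅ i)
insertAt-⁅⁆ (suc i) (suc j) = cong (false ∷_) (insertAt-⁅⁆ i j)

insertAt-removeAt-false : ∀ {m} (s : Subset (suc m)) (i : Fin (suc m)) → lookup s i ≡ false →
  insertAt (removeAt s i) i false ≡ s
insertAt-removeAt-false s i i∉s = subst (λ b → insertAt (removeAt s i) i b ≡ s) i∉s (insertAt-removeAt s i)

lookup-removeAt : ∀ {m} (s : Subset (suc m)) (i : Fin (suc m)) (x : Fin m) → lookup s i ≡ false →
  lookup s (punchIn i x) ≡ lookup (removeAt s i) x
lookup-removeAt s i x i∉s =
  trans (cong (λ t → lookup t (punchIn i x)) (sym (insertAt-removeAt-false s i i∉s)))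
        (insertAt-punchIn (removeAt s i) i false x)

toℕ-punchIn≤ : ∀ {m} (i : Fin (suc m)) (j : Fin m) → toℕ (punchIn i j) ≤ suc (toℕ j)
toℕ-punchIn≤ zero j = ≤-refl
toℕ-punchIn≤ (suc i) zero = z≤n
toℕ-punchIn≤ (suc i) (suc j) = s≤s (toℕ-punchIn≤ i j)

toℕ-punchIn-above : ∀ {m} (i : Fin (suc m)) (j : Fin m) → toℕ i ≤ toℕ j → toℕ (punchIn i j) ≡ suc (toℕ j)
toℕ-punchIn-above zero j _ = refl
toℕ-punchIn-above (suc i) (suc j) (s≤s i≤j) = cong suc (toℕ-punchIn-above i j i≤j)

punchIn-onto : ∀ {m} (i x : Fin (suc m)) → x ≢ i → ∃ λ x′ → punchIn i x′ ≡ x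
punchIn-onto i x x≢i = punchOut (λ i≡x → x≢i (sym i≡x)) , punchIn-punchOut (λ i≡x → x≢i (sym i≡x))

NoSingletonFrom : ∀ {m} → ℕ → (Subset m → Bool) → Set
NoSingletonFrom {m} c χ = ∀ (j : Fin m) → c ≤ toℕ j → χ ⁅ j ⁆ ≡ false

noSingletonFrom? : ∀ {m} c (χ : Subset m → Bool) → Dec (NoSingletonFrom c χ)
noSingletonFrom? c χ = all? (λ j → (c ≤? toℕ j) →-dec (χ ⁅ j ⁆ ≟ᵇ false))

NoSingletonFrom-cong : ∀ {m} c {χ χ′ : Subset m → Bool} → χ ≗ χ′ →
  NoSingletonFrom c χ → NoSingletonFrom c χ′
NoSingletonFrom-cong c χ≗χ′ none j c≤j = trans (sym (χ≗χ′ _)) (none j c≤j)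

noSingletonFromᵇ : ∀ {m} → ℕ → List (Subset m) → Bool
noSingletonFromᵇ c bs = does (noSingletonFrom? c (memberᵇ bs))

noSingletonFromᵇ⁻ : ∀ {m} c (bs : List (Subset m)) →
  noSingletonFromᵇ c bs ≡ true → NoSingletonFrom c (memberᵇ bs)
noSingletonFromᵇ⁻ c bs = dec-true⁻¹ (noSingletonFrom? c (memberᵇ bs))

noSingletonFromᵇ⁺ : ∀ {m} c (bs : List (Subset m)) →
  NoSingletonFrom c (memberᵇ bs) → noSingletonFromᵇ c bs ≡ true
noSingletonFromᵇ⁺ c bs = dec-true (noSingletonFrom? c (memberᵇ bs))

module SingletonDeletion {m : ℕ} (i : Fin (suc m)) where

  P : (Subset (suc m) → Bool) → Set
  P χ = IsPartitionIndicator χ × χ ⁅ i ⁆ ≡ true × NoSingletonFrom (suc (toℕ i)) χ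

  P′ : (Subset m → Bool) → Set
  P′ ψ = IsPartitionIndicator ψ × NoSingletonFrom (toℕ i) ψ

  Φ : (Subset (suc m) → Bool) → (Subset m → Bool)
  Φ χ s = χ (insertAt s i false)

  Ψ : (Subset m → Bool) → (Subset (suc m) → Bool)
  Ψ ψ s = if does (s ≟S ⁅ i ⁆) then true else (if lookup s i then false else ψ (removeAt s i))

  Ψ-⁅i⁆ : ∀ ψ → Ψ ψ ⁅ i ⁆ ≡ true
  Ψ-⁅i⁆ ψ rewrite dec-true (⁅ i ⁆ ≟S ⁅ i ⁆) refl = refl

  insertAt-false≢⁅i⁆ : ∀ s → insertAt s i false ≢ ⁅ i ⁆
  insertAt-false≢⁅i⁆ s eq =
    false≢true (trans (sym (insertAt-lookup s i false)) (trans (cong (λ t → lookup t i) eq) (lookup-⁅i⁆-i i)))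

  Ψ-insertAt : ∀ ψ s → Ψ ψ (insertAt s i false) ≡ ψ s
  Ψ-insertAt ψ s rewrite dec-false (insertAt s i false ≟S ⁅ i ⁆) (insertAt-false≢⁅i⁆ s)
                       | insertAt-lookup s i false | removeAt-insertAt s i false = refl

  Ψ-true⇒ : ∀ ψ s → Ψ ψ s ≡ true → s ≡ ⁅ i ⁆ ⊎ (lookup s i ≡ false × ψ (removeAt s i) ≡ true)
  Ψ-true⇒ ψ s Ψs with s ≟S ⁅ i ⁆
  ... | yes s≡⁅i⁆ = inj₁ s≡⁅i⁆
  ... | no _ with lookup s i
  ... | false = inj₂ (refl , Ψs)

  Ψ-cong : ∀ {ψ ψ′} → ψ ≗ ψ′ → Ψ ψ ≗ Ψ ψ′
  Ψ-cong ψ≗ψ′ s with does (s ≟S ⁅ i ⁆)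
  ... | true = refl
  ... | false with lookup s i
  ... | true = refl
  ... | false = ψ≗ψ′ (removeAt s i)

  Φ-isPartitionIndicator : ∀ χ → IsPartitionIndicator χ → χ ⁅ i ⁆ ≡ true → IsPartitionIndicator (Φ χ)
  Φ-isPartitionIndicator χ π χ⁅i⁆ = record { nonempty = nonempty′ ; disjoint = disjoint′ ; covering = covering′ }
    where
    nonempty′ : ∀ s → Φ χ s ≡ true → ∃ λ x → lookup s x ≡ true
    nonempty′ s Φχs with nonempty π _ Φχs
    ... | x , x∈ with x ≟ᶠ i
    ... | yes refl = ⊥-elim (false≢true (trans (sym (insertAt-lookup s i false)) x∈))
    ... | no x≢i with punchIn-onto i x x≢i
    ... | x′ , refl = x′ , trans (sym (insertAt-punchIn s i false x′)) x∈
    disjoint′ : ∀ s t x → Φ χ s ≡ true → Φ χ t ≡ true → lookup s x ≡ true → lookup t x ≡ true → s ≡ t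
    disjoint′ s t x Φχs Φχt x∈s x∈t =
      trans (sym (removeAt-insertAt s i false))
        (trans (cong (λ u → removeAt u i)
          (disjoint π _ _ (punchIn i x) Φχs Φχt (trans (insertAt-punchIn s i false x) x∈s)
                                             (trans (insertAt-punchIn t i false x) x∈t)))
          (removeAt-insertAt t i false))
    covering′ : ∀ x → ∃ λ s → Φ χ s ≡ true × lookup s x ≡ true
    covering′ x with covering π (punchIn i x)
    ... | s , χs , x∈s with lookup s i in i∈s
    ... | true = ⊥-elim (punchInᵢ≢i i x (sym (lookup-⁅⁆⇒≡ i (punchIn i x)
                   (subst (λ u → lookup u (punchIn i x) ≡ true) (disjoint π s ⁅ i ⁆ i χs χ⁅i⁆ i∈s (lookup-⁅i⁆-i i)) x∈s))))
    ... | false = removeAt s i , trans (cong χ (insertAt-removeAt-false s i i∈s)) χs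
                , trans (sym (lookup-removeAt s i x i∈s)) x∈s

  Φ-preserves : ∀ χ → P χ → P′ (Φ χ)
  Φ-preserves χ (π , χ⁅i⁆ , none) = Φ-isPartitionIndicator χ π χ⁅i⁆ , none′
    where
    none′ : NoSingletonFrom (toℕ i) (Φ χ)
    none′ j i≤j = trans (cong χ (insertAt-⁅⁆ i j))
                        (none (punchIn i j) (subst (suc (toℕ i) ≤_) (sym (toℕ-punchIn-above i j i≤j)) (s≤s i≤j)))

  Ψ-disjoint : ∀ ψ → IsPartitionIndicator ψ → ∀ s t x → Ψ ψ s ≡ true → Ψ ψ t ≡ true →
    lookup s x ≡ true → lookup t x ≡ true → s ≡ t
  Ψ-disjoint ψ π s t x Ψs Ψt x∈s x∈t with Ψ-true⇒ ψ s Ψs | Ψ-true⇒ ψ t Ψt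
  ... | inj₁ refl | inj₁ refl = refl
  ... | inj₁ refl | inj₂ (i∉t , _) =
    ⊥-elim (false≢true (trans (sym i∉t) (subst (λ y → lookup t y ≡ true) (sym (lookup-⁅⁆⇒≡ i x x∈s)) x∈t)))
  ... | inj₂ (i∉s , _) | inj₁ refl =
    ⊥-elim (false≢true (trans (sym i∉s) (subst (λ y → lookup s y ≡ true) (sym (lookup-⁅⁆⇒≡ i x x∈t)) x∈s)))
  ... | inj₂ (i∉s , ψs) | inj₂ (i∉t , ψt) with x ≟ᶠ i
  ... | yes refl = ⊥-elim (false≢true (trans (sym i∉s) x∈s))
  ... | no x≢i with punchIn-onto i x x≢i
  ... | x′ , refl =
    trans (sym (insertAt-removeAt-false s i i∉s))
      (trans (cong (λ u → insertAt u i false)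
               (disjoint π _ _ x′ ψs ψt (trans (sym (lookup-removeAt s i x′ i∉s)) x∈s)
                                        (trans (sym (lookup-removeAt t i x′ i∉t)) x∈t)))
             (insertAt-removeAt-false t i i∉t))

  Ψ-isPartitionIndicator : ∀ ψ → IsPartitionIndicator ψ → IsPartitionIndicator (Ψ ψ)
  Ψ-isPartitionIndicator ψ π = record { nonempty = nonempty′ ; disjoint = Ψ-disjoint ψ π ; covering = covering′ }
    where
    nonempty′ : ∀ s → Ψ ψ s ≡ true → ∃ λ x → lookup s x ≡ true
    nonempty′ s Ψs with Ψ-true⇒ ψ s Ψs
    ... | inj₁ refl = i , lookup-⁅i⁆-i i
    ... | inj₂ (i∉s , ψs) with nonempty π _ ψs
    ... | x , x∈ = punchIn i x , trans (lookup-removeAt s i x i∉s) x∈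
    covering′ : ∀ x → ∃ λ s → Ψ ψ s ≡ true × lookup s x ≡ true
    covering′ x with x ≟ᶠ i
    ... | yes refl = ⁅ i ⁆ , Ψ-⁅i⁆ ψ , lookup-⁅i⁆-i i
    ... | no x≢i with punchIn-onto i x x≢i
    ... | x′ , refl with covering π x′
    ... | t , ψt , x′∈t = insertAt t i false , trans (Ψ-insertAt ψ t) ψt , trans (insertAt-punchIn t i false x′) x′∈t

  Ψ-preserves : ∀ ψ → P′ ψ → P (Ψ ψ)
  Ψ-preserves ψ (π , none) = Ψ-isPartitionIndicator ψ π , Ψ-⁅i⁆ ψ , none′
    where
    none′ : NoSingletonFrom (suc (toℕ i)) (Ψ ψ)
    none′ j i<j with j ≟ᶠ i
    ... | yes refl = ⊥-elim (<⇒≱ i<j ≤-refl)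
    ... | no j≢i with punchIn-onto i j j≢i
    ... | j′ , refl = trans (cong (Ψ ψ) (sym (insertAt-⁅⁆ i j′)))
                            (trans (Ψ-insertAt ψ ⁅ j′ ⁆) (none j′ (≤-pred (≤-trans i<j (toℕ-punchIn≤ i j′)))))

  Ψ∘Φ : ∀ χ → P χ → Ψ (Φ χ) ≗ χ
  Ψ∘Φ χ (π , χ⁅i⁆ , _) s with s ≟S ⁅ i ⁆
  ... | yes refl = sym χ⁅i⁆
  ... | no s≢⁅i⁆ with lookup s i in i∈s
  ... | false = cong χ (insertAt-removeAt-false s i i∈s)
  ... | true with χ s in χs
  ... | false = refl
  ... | true = ⊥-elim (s≢⁅i⁆ (disjoint π s ⁅ i ⁆ i χs χ⁅i⁆ i∈s (lookup-⁅i⁆-i i)))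

  bijection : IndicatorBijection (suc m) m
  bijection = record
    { P = P ; P′ = P′
    ; P-resp = λ χ≗χ′ (π , χ⁅i⁆ , none) →
        IsPartitionIndicator-cong χ≗χ′ π , trans (sym (χ≗χ′ _)) χ⁅i⁆ , NoSingletonFrom-cong (suc (toℕ i)) χ≗χ′ none
    ; P′-resp = λ ψ≗ψ′ (π , none) → IsPartitionIndicator-cong ψ≗ψ′ π , NoSingletonFrom-cong (toℕ i) ψ≗ψ′ none
    ; p = λ bs → isPartitionᵇ bs ∧ (memberᵇ bs ⁅ i ⁆ ∧ noSingletonFromᵇ (suc (toℕ i)) bs)
    ; p′ = λ bs → isPartitionᵇ bs ∧ noSingletonFromᵇ (toℕ i) bs
    ; p⇒P = λ bs _ pbs → let (isP , rest) = ∧-true⁻ pbs ; (i∈ , none) = ∧-true⁻ rest in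
        isPartitionᵇ⇒indicator bs isP , i∈ , noSingletonFromᵇ⁻ (suc (toℕ i)) bs none
    ; P⇒p = λ bs bs∈ (π , i∈ , none) →
        ∧-true⁺ (indicator⇒isPartitionᵇ bs bs∈ π) (∧-true⁺ i∈ (noSingletonFromᵇ⁺ (suc (toℕ i)) bs none))
    ; p′⇒P′ = λ bs _ pbs → let (isP , none) = ∧-true⁻ pbs in
        isPartitionᵇ⇒indicator bs isP , noSingletonFromᵇ⁻ (toℕ i) bs none
    ; P′⇒p′ = λ bs bs∈ (π , none) →
        ∧-true⁺ (indicator⇒isPartitionᵇ bs bs∈ π) (noSingletonFromᵇ⁺ (toℕ i) bs none)
    ; Φ = Φ ; Ψ = Ψ
    ; Φ-cong = λ χ≗χ′ s → χ≗χ′ _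
    ; Ψ-cong = Ψ-cong
    ; Φ-preserves = Φ-preserves ; Ψ-preserves = Ψ-preserves
    ; Ψ∘Φ = Ψ∘Φ ; Φ∘Ψ = λ ψ _ → Ψ-insertAt ψ }

∨-true⁻ : ∀ {a b} → a ∨ b ≡ true → a ≡ true ⊎ b ≡ true
∨-true⁻ {true} _ = inj₁ refl
∨-true⁻ {false} b = inj₂ b

module _ {a} {A : Set a} where

  any-cong : ∀ {p q : A → Bool} → p ≗ q → (xs : List A) → any p xs ≡ any q xs
  any-cong p≗q [] = refl
  any-cong p≗q (x ∷ xs) = cong₂ _∨_ (p≗q x) (any-cong p≗q xs)

  any-true⁺ : ∀ (p : A → Bool) {xs x} → x ∈ xs → p x ≡ true → any p xs ≡ true
  any-true⁺ p (here refl) px rewrite px = refl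
  any-true⁺ p {y ∷ _} (there x∈) px rewrite any-true⁺ p x∈ px = ∨-zeroʳ (p y)

  any-true⁻ : ∀ (p : A → Bool) xs → any p xs ≡ true → ∃ λ x → x ∈ xs × p x ≡ true
  any-true⁻ p (x ∷ xs) any-p with p x in px
  ... | true = x , here refl , px
  ... | false with any-true⁻ p xs any-p
  ... | y , y∈ , py = y , there y∈ , py

-- Φ deletes the point 0 and breaks the rest of its block into singletons;
-- Ψ merges all singleton blocks together with 0.
module SingletonMerge {k : ℕ} where

  inZeroBlock : (Subset (suc k) → Bool) → Fin k → Bool
  inZeroBlock χ x = any (λ t → χ (true ∷ t) ∧ lookup t x) (allSubsets k)

  zeroBlockSingleton : (Subset (suc k) → Bool) → Subset k → Bool
  zeroBlockSingleton χ s = any (λ x → does (s ≟S ⁅ x ⁆) ∧ inZeroBlock χ x) (allFin k)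

  isSingletonᵇ : Subset k → Bool
  isSingletonᵇ s = any (λ x → does (s ≟S ⁅ x ⁆)) (allFin k)

  singletonUnion : (Subset k → Bool) → Subset k
  singletonUnion ψ = tabulate (λ x → ψ ⁅ x ⁆)

  Φ : (Subset (suc k) → Bool) → (Subset k → Bool)
  Φ χ s = χ (false ∷ s) ∨ zeroBlockSingleton χ s

  Ψ : (Subset k → Bool) → (Subset (suc k) → Bool)
  Ψ ψ (true ∷ t) = does (t ≟S singletonUnion ψ)
  Ψ ψ (false ∷ t) = ψ t ∧ not (isSingletonᵇ t)

  P : (Subset (suc k) → Bool) → Set
  P χ = IsPartitionIndicator χ × NoSingletonFrom 1 χ

  inZeroBlock⁻ : ∀ χ x → inZeroBlock χ x ≡ true → ∃ λ t → χ (true ∷ t) ≡ true × lookup t x ≡ true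
  inZeroBlock⁻ χ x x∈ with any-true⁻ _ (allSubsets k) x∈
  ... | t , _ , χt∧x∈t = t , ∧-true⁻ χt∧x∈t

  inZeroBlock⁺ : ∀ χ x t → χ (true ∷ t) ≡ true → lookup t x ≡ true → inZeroBlock χ x ≡ true
  inZeroBlock⁺ χ x t χt x∈t = any-true⁺ _ (allSubsets-complete t) (∧-true⁺ χt x∈t)

  zeroBlockSingleton⁻ : ∀ χ s → zeroBlockSingleton χ s ≡ true → ∃ λ x → s ≡ ⁅ x ⁆ × inZeroBlock χ x ≡ true
  zeroBlockSingleton⁻ χ s z with any-true⁻ _ (allFin k) z
  ... | x , _ , s≡∧x∈ with ∧-true⁻ s≡∧x∈
  ... | s≡ , x∈ = x , dec-true⁻¹ (s ≟S ⁅ x ⁆) s≡ , x∈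

  zeroBlockSingleton-⁅⁆ : ∀ χ x → zeroBlockSingleton χ ⁅ x ⁆ ≡ inZeroBlock χ x
  zeroBlockSingleton-⁅⁆ χ x = ≡true-⇔⇒≡
    (λ z → let (y , ⁅x⁆≡⁅y⁆ , y∈) = zeroBlockSingleton⁻ χ ⁅ x ⁆ z in
           subst (λ w → inZeroBlock χ w ≡ true) (sym (⁅⁆-injective ⁅x⁆≡⁅y⁆)) y∈)
    (λ x∈ → any-true⁺ _ (∈-allFin x) (∧-true⁺ (dec-true (⁅ x ⁆ ≟S ⁅ x ⁆) refl) x∈))

  isSingletonᵇ⁻ : ∀ s → isSingletonᵇ s ≡ true → ∃ λ x → s ≡ ⁅ x ⁆
  isSingletonᵇ⁻ s sing with any-true⁻ _ (allFin k) sing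
  ... | x , _ , s≡ = x , dec-true⁻¹ (s ≟S ⁅ x ⁆) s≡

  isSingletonᵇ-⁅⁆ : ∀ x → isSingletonᵇ ⁅ x ⁆ ≡ true
  isSingletonᵇ-⁅⁆ x = any-true⁺ _ (∈-allFin x) (dec-true (⁅ x ⁆ ≟S ⁅ x ⁆) refl)

  zeroBlockSingleton-nonsingleton : ∀ χ s → isSingletonᵇ s ≡ false → zeroBlockSingleton χ s ≡ false
  zeroBlockSingleton-nonsingleton χ s nonsing with zeroBlockSingleton χ s in z
  ... | false = refl
  ... | true with zeroBlockSingleton⁻ χ s z
  ... | x , refl , _ = ⊥-elim (false≢true (trans (sym nonsing) (isSingletonᵇ-⁅⁆ x)))

  Φ-true⇒ : ∀ χ s → Φ χ s ≡ true → χ (false ∷ s) ≡ true ⊎ ∃ λ x → s ≡ ⁅ x ⁆ × inZeroBlock χ x ≡ true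
  Φ-true⇒ χ s Φχs with ∨-true⁻ {χ (false ∷ s)} Φχs
  ... | inj₁ χs = inj₁ χs
  ... | inj₂ z = inj₂ (zeroBlockSingleton⁻ χ s z)

  Φ-disjoint : ∀ χ → IsPartitionIndicator χ → ∀ s t x → Φ χ s ≡ true → Φ χ t ≡ true →
    lookup s x ≡ true → lookup t x ≡ true → s ≡ t
  Φ-disjoint χ π s t x Φs Φt x∈s x∈t with Φ-true⇒ χ s Φs | Φ-true⇒ χ t Φt
  ... | inj₁ χs | inj₁ χt = cong tail (disjoint π _ _ (suc x) χs χt x∈s x∈t)
  ... | inj₁ χs | inj₂ (y , refl , y∈) with lookup-⁅⁆⇒≡ y x x∈t
  ... | refl with inZeroBlock⁻ χ y y∈
  ... | u , χu , y∈u with disjoint π _ _ (suc y) χs χu x∈s y∈u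
  ... | ()
  Φ-disjoint χ π s t x Φs Φt x∈s x∈t | inj₂ (y , refl , y∈) | inj₁ χt with lookup-⁅⁆⇒≡ y x x∈s
  ... | refl with inZeroBlock⁻ χ y y∈
  ... | u , χu , y∈u with disjoint π _ _ (suc y) χt χu x∈t y∈u
  ... | ()
  Φ-disjoint χ π s t x Φs Φt x∈s x∈t | inj₂ (y , refl , _) | inj₂ (y′ , refl , _)
    with lookup-⁅⁆⇒≡ y x x∈s | lookup-⁅⁆⇒≡ y′ x x∈t
  ... | refl | refl = refl

  Φ-preserves : ∀ χ → P χ → IsPartitionIndicator (Φ χ)
  Φ-preserves χ (π , _) = record { nonempty = nonempty′ ; disjoint = Φ-disjoint χ π ; covering = covering′ }
    where
    nonempty′ : ∀ s → Φ χ s ≡ true → ∃ λ x → lookup s x ≡ true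
    nonempty′ s Φs with Φ-true⇒ χ s Φs
    ... | inj₂ (x , refl , _) = x , lookup-⁅i⁆-i x
    ... | inj₁ χs with nonempty π _ χs
    ... | zero , ()
    ... | suc x , x∈ = x , x∈
    covering′ : ∀ x → ∃ λ s → Φ χ s ≡ true × lookup s x ≡ true
    covering′ x with covering π (suc x)
    ... | (false ∷ s) , χs , x∈ = s , cong (_∨ zeroBlockSingleton χ s) χs , x∈
    ... | (true ∷ u) , χu , x∈ = ⁅ x ⁆
        , trans (cong (χ (false ∷ ⁅ x ⁆) ∨_) (trans (zeroBlockSingleton-⁅⁆ χ x) (inZeroBlock⁺ χ x u χu x∈)))
                (∨-zeroʳ _)
        , lookup-⁅i⁆-i x

  lookup-singletonUnion : ∀ ψ x → lookup (singletonUnion ψ) x ≡ ψ ⁅ x ⁆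
  lookup-singletonUnion ψ x = lookup∘tabulate _ x

  Ψ-true⇒ : ∀ ψ S → Ψ ψ S ≡ true →
    S ≡ true ∷ singletonUnion ψ ⊎ ∃ λ t → S ≡ false ∷ t × ψ t ≡ true × isSingletonᵇ t ≡ false
  Ψ-true⇒ ψ (true ∷ t) Ψt = inj₁ (cong (true ∷_) (dec-true⁻¹ (t ≟S singletonUnion ψ) Ψt))
  Ψ-true⇒ ψ (false ∷ t) Ψt with ψ t in ψt | isSingletonᵇ t in sing
  ... | true | false = inj₂ (t , refl , ψt , sing)

  Ψ-zeroBlock : ∀ ψ → Ψ ψ (true ∷ singletonUnion ψ) ≡ true
  Ψ-zeroBlock ψ = dec-true (singletonUnion ψ ≟S singletonUnion ψ) refl

  zeroBlock-apart : ∀ ψ → IsPartitionIndicator ψ → ∀ t → ψ t ≡ true → isSingletonᵇ t ≡ false → ∀ x →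
    lookup (true ∷ singletonUnion ψ) x ≡ true → lookup (false ∷ t) x ≡ true → ⊥
  zeroBlock-apart ψ π t ψt nonsing (suc y) y∈U y∈t
    with disjoint π t ⁅ y ⁆ y ψt (trans (sym (lookup-singletonUnion ψ y)) y∈U) y∈t (lookup-⁅i⁆-i y)
  ... | refl = false≢true (trans (sym nonsing) (isSingletonᵇ-⁅⁆ y))

  Ψ-disjoint : ∀ ψ → IsPartitionIndicator ψ → ∀ S T x → Ψ ψ S ≡ true → Ψ ψ T ≡ true →
    lookup S x ≡ true → lookup T x ≡ true → S ≡ T
  Ψ-disjoint ψ π S T x ΨS ΨT x∈S x∈T with Ψ-true⇒ ψ S ΨS | Ψ-true⇒ ψ T ΨT
  ... | inj₁ refl | inj₁ refl = refl
  ... | inj₁ refl | inj₂ (t , refl , ψt , nonsing) = ⊥-elim (zeroBlock-apart ψ π t ψt nonsing x x∈S x∈T)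
  ... | inj₂ (t , refl , ψt , nonsing) | inj₁ refl = ⊥-elim (zeroBlock-apart ψ π t ψt nonsing x x∈T x∈S)
  ... | inj₂ (t , refl , ψt , _) | inj₂ (t′ , refl , ψt′ , _) with x
  ... | zero = ⊥-elim (false≢true x∈S)
  ... | suc y = cong (false ∷_) (disjoint π _ _ y ψt ψt′ x∈S x∈T)

  Ψ-preserves : ∀ ψ → IsPartitionIndicator ψ → P (Ψ ψ)
  Ψ-preserves ψ π = record { nonempty = nonempty′ ; disjoint = Ψ-disjoint ψ π ; covering = covering′ } , none
    where
    nonempty′ : ∀ S → Ψ ψ S ≡ true → ∃ λ x → lookup S x ≡ true
    nonempty′ S ΨS with Ψ-true⇒ ψ S ΨS
    ... | inj₁ refl = zero , refl
    ... | inj₂ (t , refl , ψt , _) with nonempty π t ψt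
    ... | x , x∈ = suc x , x∈
    covering′ : ∀ x → ∃ λ S → Ψ ψ S ≡ true × lookup S x ≡ true
    covering′ zero = (true ∷ singletonUnion ψ) , Ψ-zeroBlock ψ , refl
    covering′ (suc y) with covering π y
    ... | t , ψt , y∈t with isSingletonᵇ t in sing
    ... | false = (false ∷ t) , cong₂ _∧_ ψt (cong not sing) , y∈t
    ... | true with isSingletonᵇ⁻ t sing
    ... | z , refl with lookup-⁅⁆⇒≡ z y y∈t
    ... | refl = (true ∷ singletonUnion ψ) , Ψ-zeroBlock ψ , trans (lookup-singletonUnion ψ y) ψt
    none : NoSingletonFrom 1 (Ψ ψ)
    none (suc j) _ rewrite isSingletonᵇ-⁅⁆ j = ∧-zeroʳ (ψ ⁅ j ⁆)

  Ψ∘Φ : ∀ χ → P χ → Ψ (Φ χ) ≗ χ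
  Ψ∘Φ χ (π , none) = Ψ∘Φ≗
    where
    Φ-⁅⁆ : ∀ x → Φ χ ⁅ x ⁆ ≡ inZeroBlock χ x
    Φ-⁅⁆ x = trans (cong (_∨ zeroBlockSingleton χ ⁅ x ⁆) (none (suc x) (s≤s z≤n))) (zeroBlockSingleton-⁅⁆ χ x)
    zeroBlock≡ : ∀ u → χ (true ∷ u) ≡ true → u ≡ singletonUnion (Φ χ)
    zeroBlock≡ u χu = trans (sym (tabulate∘lookup u)) (tabulate-cong λ x →
      trans (≡true-⇔⇒≡ (inZeroBlock⁺ χ x u χu)
        (λ x∈ → let (w , χw , x∈w) = inZeroBlock⁻ χ x x∈ in
          subst (λ v → lookup v x ≡ true) (cong tail (disjoint π _ _ zero χw χu refl refl)) x∈w))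
        (sym (Φ-⁅⁆ x)))
    zeroBlock-exists : ∃ λ u → χ (true ∷ u) ≡ true
    zeroBlock-exists with covering π zero
    ... | (true ∷ u) , χu , _ = u , χu
    Ψ∘Φ≗ : ∀ S → Ψ (Φ χ) S ≡ χ S
    Ψ∘Φ≗ (true ∷ t) with χ (true ∷ t) in χt
    ... | true = dec-true (t ≟S singletonUnion (Φ χ)) (zeroBlock≡ t χt)
    ... | false = dec-false (t ≟S singletonUnion (Φ χ)) λ t≡ →
      let (u , χu) = zeroBlock-exists in
      false≢true (trans (sym χt) (subst (λ v → χ (true ∷ v) ≡ true) (trans (zeroBlock≡ u χu) (sym t≡)) χu))
    Ψ∘Φ≗ (false ∷ t) with isSingletonᵇ t in sing
    ... | true with isSingletonᵇ⁻ t sing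
    ... | x , refl = trans (∧-zeroʳ _) (sym (none (suc x) (s≤s z≤n)))
    Ψ∘Φ≗ (false ∷ t) | false rewrite zeroBlockSingleton-nonsingleton χ t sing =
      trans (∧-identityʳ _) (∨-identityʳ _)

  inZeroBlock-Ψ : ∀ ψ x → inZeroBlock (Ψ ψ) x ≡ ψ ⁅ x ⁆
  inZeroBlock-Ψ ψ x = ≡true-⇔⇒≡
    (λ x∈ → let (t , Ψt , x∈t) = inZeroBlock⁻ (Ψ ψ) x x∈ in
      trans (sym (lookup-singletonUnion ψ x))
            (subst (λ v → lookup v x ≡ true) (dec-true⁻¹ (t ≟S singletonUnion ψ) Ψt) x∈t))
    (λ ψ⁅x⁆ → inZeroBlock⁺ (Ψ ψ) x (singletonUnion ψ) (Ψ-zeroBlock ψ) (trans (lookup-singletonUnion ψ x) ψ⁅x⁆))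

  Φ∘Ψ : ∀ ψ → Φ (Ψ ψ) ≗ ψ
  Φ∘Ψ ψ s with isSingletonᵇ s in sing
  ... | true with isSingletonᵇ⁻ s sing
  ... | x , refl rewrite isSingletonᵇ-⁅⁆ x =
    trans (cong ((ψ ⁅ x ⁆ ∧ false) ∨_) (trans (zeroBlockSingleton-⁅⁆ (Ψ ψ) x) (inZeroBlock-Ψ ψ x)))
          (cong (_∨ ψ ⁅ x ⁆) (∧-zeroʳ (ψ ⁅ x ⁆)))
  Φ∘Ψ ψ s | false rewrite zeroBlockSingleton-nonsingleton (Ψ ψ) s sing = trans (∨-identityʳ _) (∧-identityʳ _)

  Φ-cong : ∀ {χ χ′} → χ ≗ χ′ → Φ χ ≗ Φ χ′
  Φ-cong χ≗χ′ s = cong₂ _∨_ (χ≗χ′ (false ∷ s))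
    (any-cong (λ x → cong (does (s ≟S ⁅ x ⁆) ∧_) (any-cong (λ t → cong (_∧ lookup t x) (χ≗χ′ (true ∷ t))) (allSubsets k)))
              (allFin k))

  Ψ-cong : ∀ {ψ ψ′} → ψ ≗ ψ′ → Ψ ψ ≗ Ψ ψ′
  Ψ-cong ψ≗ψ′ (true ∷ t) = cong (λ v → does (t ≟S v)) (tabulate-cong (λ x → ψ≗ψ′ ⁅ x ⁆))
  Ψ-cong ψ≗ψ′ (false ∷ t) = cong (_∧ not (isSingletonᵇ t)) (ψ≗ψ′ t)

  bijection : IndicatorBijection (suc k) k
  bijection = record
    { P = P ; P′ = IsPartitionIndicator
    ; P-resp = λ χ≗χ′ (π , none) → IsPartitionIndicator-cong χ≗χ′ π , NoSingletonFrom-cong 1 χ≗χ′ none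
    ; P′-resp = IsPartitionIndicator-cong
    ; p = λ bs → isPartitionᵇ bs ∧ noSingletonFromᵇ 1 bs
    ; p′ = isPartitionᵇ
    ; p⇒P = λ bs _ pbs → let (isP , none) = ∧-true⁻ pbs in
        isPartitionᵇ⇒indicator bs isP , noSingletonFromᵇ⁻ 1 bs none
    ; P⇒p = λ bs bs∈ (π , none) → ∧-true⁺ (indicator⇒isPartitionᵇ bs bs∈ π) (noSingletonFromᵇ⁺ 1 bs none)
    ; p′⇒P′ = λ bs _ → isPartitionᵇ⇒indicator bs
    ; P′⇒p′ = indicator⇒isPartitionᵇ
    ; Φ = Φ ; Ψ = Ψ ; Φ-cong = Φ-cong ; Ψ-cong = Ψ-cong
    ; Φ-preserves = Φ-preserves ; Ψ-preserves = Ψ-preserves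
    ; Ψ∘Φ = Ψ∘Φ ; Φ∘Ψ = λ ψ _ → Φ∘Ψ ψ }

restrictedBell : ℕ → ℕ → ℕ
restrictedBell m c = count (λ bs → isPartitionᵇ bs ∧ noSingletonFromᵇ c bs) (families m)

count-isPartitionᵇ≡restrictedBell : ∀ m → count isPartitionᵇ (families m) ≡ restrictedBell m m
count-isPartitionᵇ≡restrictedBell m =
  count-cong (λ bs → sym (trans (cong (isPartitionᵇ bs ∧_) (vacuous bs)) (∧-identityʳ _))) (families m)
  where
  vacuous : ∀ (bs : List (Subset m)) → noSingletonFromᵇ m bs ≡ true
  vacuous bs = noSingletonFromᵇ⁺ m bs (λ j m≤j → ⊥-elim (<⇒≱ (toℕ<n j) m≤j))

Bell≡restrictedBell : ∀ m → Bell m ≡ restrictedBell m m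
Bell≡restrictedBell m = trans (length-filter≡count isPartition? (families m)) (count-isPartitionᵇ≡restrictedBell m)

restrictedBell-singletonDeletion : ∀ {m} (i : Fin (suc m)) →
  count (λ bs → isPartitionᵇ bs ∧ (memberᵇ bs ⁅ i ⁆ ∧ noSingletonFromᵇ (suc (toℕ i)) bs)) (families (suc m))
  ≡ restrictedBell m (toℕ i)
restrictedBell-singletonDeletion i = count-transfer (SingletonDeletion.bijection i)

restrictedBell-1 : ∀ k → restrictedBell (suc k) 1 ≡ restrictedBell k k
restrictedBell-1 k = trans (count-transfer (SingletonMerge.bijection {k})) (count-isPartitionᵇ≡restrictedBell k)

largestSingleton?-characterisation : ∀ {n} (i : Fin (suc n)) (bs : List (Subset (suc n))) →
  does (largestSingleton? bs (toℕ i)) ≡ memberᵇ bs ⁅ i ⁆ ∧ noSingletonFromᵇ (suc (toℕ i)) bs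
largestSingleton?-characterisation i bs = ≡true-⇔⇒≡ to from
  where
  to : does (largestSingleton? bs (toℕ i)) ≡ true → memberᵇ bs ⁅ i ⁆ ∧ noSingletonFromᵇ (suc (toℕ i)) bs ≡ true
  to ls with dec-true⁻¹ (largestSingleton? bs (toℕ i)) ls
  ... | (j , j≡i , ⁅j⁆∈) , above = ∧-true⁺
    (memberᵇ⁺ bs ⁅ i ⁆ (subst (λ v → ⁅ v ⁆ ∈ bs) (toℕ-injective j≡i) (Any.map sym ⁅j⁆∈)))
    (noSingletonFromᵇ⁺ (suc (toℕ i)) bs none)
    where
    none : NoSingletonFrom (suc (toℕ i)) (memberᵇ bs)
    none j′ i<j′ with memberᵇ bs ⁅ j′ ⁆ in ⁅j′⁆∈
    ... | false = refl
    ... | true = ⊥-elim (above j′ i<j′ (Any.map sym (memberᵇ⁻ bs _ ⁅j′⁆∈)))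
  from : memberᵇ bs ⁅ i ⁆ ∧ noSingletonFromᵇ (suc (toℕ i)) bs ≡ true → does (largestSingleton? bs (toℕ i)) ≡ true
  from i∧none with ∧-true⁻ i∧none
  ... | ⁅i⁆∈ , none = dec-true (largestSingleton? bs (toℕ i))
    ( (i , refl , Any.map sym (memberᵇ⁻ bs _ ⁅i⁆∈))
    , λ j i<j ⁅j⁆∈ → false≢true (trans (sym (noSingletonFromᵇ⁻ (suc (toℕ i)) bs none j i<j))
                                       (memberᵇ⁺ bs _ (Any.map sym ⁅j⁆∈))) )

A≡restrictedBell : ∀ {n k} → k < suc n → A n k ≡ restrictedBell n k
A≡restrictedBell {n} {k} k<1+n =
  subst (λ c → A n c ≡ restrictedBell n c) (toℕ-fromℕ< k<1+n) (A-toℕ (fromℕ< k<1+n))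
  where
  A-toℕ : (i : Fin (suc n)) → A n (toℕ i) ≡ restrictedBell n (toℕ i)
  A-toℕ i = begin
    A n (toℕ i)
      ≡⟨ length-filter≡count _ (partitions (suc n)) ⟩
    count (λ bs → does (largestSingleton? bs (toℕ i))) (partitions (suc n))
      ≡⟨ count-filter isPartition? _ (families (suc n)) ⟩
    count (λ bs → isPartitionᵇ bs ∧ does (largestSingleton? bs (toℕ i))) (families (suc n))
      ≡⟨ count-cong (λ bs → cong (isPartitionᵇ bs ∧_) (largestSingleton?-characterisation i bs)) (families (suc n)) ⟩
    count (λ bs → isPartitionᵇ bs ∧ (memberᵇ bs ⁅ i ⁆ ∧ noSingletonFromᵇ (suc (toℕ i)) bs)) (families (suc n))
      ≡⟨ restrictedBell-singletonDeletion i ⟩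
    restrictedBell n (toℕ i) ∎
    where open ≡-Reasoning

noSingletonFromᵇ-split : ∀ {m} (i : Fin m) (bs : List (Subset m)) →
  noSingletonFromᵇ (suc (toℕ i)) bs ∧ not (memberᵇ bs ⁅ i ⁆) ≡ noSingletonFromᵇ (toℕ i) bs
noSingletonFromᵇ-split i bs = ≡true-⇔⇒≡ to from
  where
  to : noSingletonFromᵇ (suc (toℕ i)) bs ∧ not (memberᵇ bs ⁅ i ⁆) ≡ true → noSingletonFromᵇ (toℕ i) bs ≡ true
  to none∧i∉ with ∧-true⁻ none∧i∉
  ... | none , i∉ = noSingletonFromᵇ⁺ _ bs none′
    where
    none′ : NoSingletonFrom (toℕ i) (memberᵇ bs)
    none′ j i≤j with m≤n⇒m<n∨m≡n i≤j
    ... | inj₁ i<j = noSingletonFromᵇ⁻ _ bs none j i<j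
    ... | inj₂ i≡j with toℕ-injective i≡j
    ... | refl = trans (sym (not-involutive _)) (cong not i∉)
  from : noSingletonFromᵇ (toℕ i) bs ≡ true → noSingletonFromᵇ (suc (toℕ i)) bs ∧ not (memberᵇ bs ⁅ i ⁆) ≡ true
  from none = ∧-true⁺ (noSingletonFromᵇ⁺ _ bs (λ j i<j → noSingletonFromᵇ⁻ _ bs none j (≤-trans (n≤1+n _) i<j)))
                      (cong not (noSingletonFromᵇ⁻ _ bs none i ≤-refl))

restrictedBell-suc : ∀ {m} (i : Fin (suc m)) →
  restrictedBell (suc m) (suc (toℕ i)) ≡ restrictedBell m (toℕ i) + restrictedBell (suc m) (toℕ i)
restrictedBell-suc {m} i = begin
  restrictedBell (suc m) (suc (toℕ i))
    ≡⟨ count-split _ (λ bs → memberᵇ bs ⁅ i ⁆) (families (suc m)) ⟩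
  count (λ bs → (isPartitionᵇ bs ∧ noSingletonFromᵇ (suc (toℕ i)) bs) ∧ memberᵇ bs ⁅ i ⁆) (families (suc m))
    + count (λ bs → (isPartitionᵇ bs ∧ noSingletonFromᵇ (suc (toℕ i)) bs) ∧ not (memberᵇ bs ⁅ i ⁆)) (families (suc m))
    ≡⟨ cong₂ _+_ (count-cong with-⁅i⁆ (families (suc m))) (count-cong without-⁅i⁆ (families (suc m))) ⟩
  count (λ bs → isPartitionᵇ bs ∧ (memberᵇ bs ⁅ i ⁆ ∧ noSingletonFromᵇ (suc (toℕ i)) bs)) (families (suc m))
    + restrictedBell (suc m) (toℕ i)
    ≡⟨ cong (_+ restrictedBell (suc m) (toℕ i)) (restrictedBell-singletonDeletion i) ⟩
  restrictedBell m (toℕ i) + restrictedBell (suc m) (toℕ i) ∎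
  where
  open ≡-Reasoning
  with-⁅i⁆ : ∀ bs → (isPartitionᵇ bs ∧ noSingletonFromᵇ (suc (toℕ i)) bs) ∧ memberᵇ bs ⁅ i ⁆
                  ≡ isPartitionᵇ bs ∧ (memberᵇ bs ⁅ i ⁆ ∧ noSingletonFromᵇ (suc (toℕ i)) bs)
  with-⁅i⁆ bs = trans (∧-assoc (isPartitionᵇ bs) _ _)
    (cong (isPartitionᵇ bs ∧_) (∧-comm (noSingletonFromᵇ (suc (toℕ i)) bs) (memberᵇ bs ⁅ i ⁆)))
  without-⁅i⁆ : ∀ bs → (isPartitionᵇ bs ∧ noSingletonFromᵇ (suc (toℕ i)) bs) ∧ not (memberᵇ bs ⁅ i ⁆)
                     ≡ isPartitionᵇ bs ∧ noSingletonFromᵇ (toℕ i) bs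
  without-⁅i⁆ bs = trans (∧-assoc (isPartitionᵇ bs) _ _) (cong (isPartitionᵇ bs ∧_) (noSingletonFromᵇ-split i bs))

A′ : ℕ → ℕ → ℕ
A′ a b = restrictedBell (a + b) a

A≡A′ : ∀ a b → A (a + b) a ≡ A′ a b
A≡A′ a b = A≡restrictedBell (s≤s (m≤m+n a b))

A′-suc : ∀ a b → A′ (suc a) b ≡ A′ a b + A′ a (suc b)
A′-suc a b = begin
  restrictedBell (suc (a + b)) (suc a)
    ≡⟨ cong (λ c → restrictedBell (suc (a + b)) (suc c)) (sym i≡a) ⟩
  restrictedBell (suc (a + b)) (suc (toℕ i))
    ≡⟨ restrictedBell-suc i ⟩
  restrictedBell (a + b) (toℕ i) + restrictedBell (suc (a + b)) (toℕ i)
    ≡⟨ cong₂ (λ c m → restrictedBell (a + b) c + restrictedBell m c) i≡a (sym (+-suc a b)) ⟩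
  restrictedBell (a + b) a + restrictedBell (a + suc b) a ∎
  where
  open ≡-Reasoning
  i : Fin (suc (a + b))
  i = fromℕ< (s≤s (m≤m+n a b))
  i≡a : toℕ i ≡ a
  i≡a = toℕ-fromℕ< (s≤s (m≤m+n a b))

A′-1 : ∀ k → A′ 1 k ≡ A′ k 0
A′-1 k = trans (restrictedBell-1 k) (cong (λ m → restrictedBell m k) (sym (+-identityʳ k)))

sumBelow : ℕ → (ℕ → ℕ) → ℕ
sumBelow zero g = 0
sumBelow (suc m) g = g 0 + sumBelow m (λ j → g (suc j))

sum-map-applyUpTo : ∀ (g h : ℕ → ℕ) m → sum (map g (applyUpTo h m)) ≡ sumBelow m (λ j → g (h j))
sum-map-applyUpTo g h zero = refl
sum-map-applyUpTo g h (suc m) = cong (g (h 0) +_) (sum-map-applyUpTo g (λ j → h (suc j)) m)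

sumTo≡sumBelow : ∀ n g → sumTo n g ≡ sumBelow (suc n) g
sumTo≡sumBelow n g = sum-map-applyUpTo g (λ j → j) (suc n)

sumBelow-cong : ∀ m {g h : ℕ → ℕ} → (∀ j → j < m → g j ≡ h j) → sumBelow m g ≡ sumBelow m h
sumBelow-cong zero _ = refl
sumBelow-cong (suc m) g≡h = cong₂ _+_ (g≡h 0 (s≤s z≤n)) (sumBelow-cong m (λ j j<m → g≡h (suc j) (s≤s j<m)))

sumBelow-+ : ∀ m (g h : ℕ → ℕ) → sumBelow m (λ j → g j + h j) ≡ sumBelow m g + sumBelow m h
sumBelow-+ zero g h = refl
sumBelow-+ (suc m) g h = trans (cong (g 0 + h 0 +_) (sumBelow-+ m (λ j → g (suc j)) (λ j → h (suc j))))
                               (interchange (g 0) (h 0) _ _)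

sumBelow-snoc : ∀ m (g : ℕ → ℕ) → sumBelow (suc m) g ≡ sumBelow m g + g m
sumBelow-snoc zero g = +-comm (g 0) 0
sumBelow-snoc (suc m) g = trans (cong (g 0 +_) (sumBelow-snoc m (λ j → g (suc j)))) (sym (+-assoc (g 0) _ _))

sumBelow-pascal : ∀ n (a : ℕ → ℕ) →
  sumBelow (suc (suc n)) (λ j → (suc n C j) * a j) ≡ sumBelow (suc n) (λ j → (n C j) * (a j + a (suc j)))
sumBelow-pascal n a = begin
  sumBelow (suc (suc n)) (λ j → (suc n C j) * a j)
    ≡⟨ cong₂ _+_ (*-identityˡ (a 0)) (sumBelow-cong (suc n) (λ j _ → pascal j)) ⟩
  a 0 + sumBelow (suc n) (λ j → (n C j) * a (suc j) + (n C suc j) * a (suc j))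
    ≡⟨ cong (a 0 +_) (sumBelow-+ (suc n) (λ j → (n C j) * a (suc j)) (λ j → (n C suc j) * a (suc j))) ⟩
  a 0 + (shifted + sumBelow (suc n) (λ j → (n C suc j) * a (suc j)))
    ≡⟨ x∙yz≈y∙xz (a 0) shifted _ ⟩
  shifted + (a 0 + sumBelow (suc n) (λ j → (n C suc j) * a (suc j)))
    ≡⟨ trans (cong (shifted +_) unshifted) (+-comm shifted _) ⟩
  sumBelow (suc n) (λ j → (n C j) * a j) + shifted
    ≡⟨ sym (sumBelow-+ (suc n) (λ j → (n C j) * a j) (λ j → (n C j) * a (suc j))) ⟩
  sumBelow (suc n) (λ j → (n C j) * a j + (n C j) * a (suc j))
    ≡⟨ sumBelow-cong (suc n) (λ j _ → sym (*-distribˡ-+ (n C j) (a j) (a (suc j)))) ⟩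
  sumBelow (suc n) (λ j → (n C j) * (a j + a (suc j))) ∎
  where
  open ≡-Reasoning
  shifted : ℕ
  shifted = sumBelow (suc n) (λ j → (n C j) * a (suc j))
  pascal : ∀ j → (suc n C suc j) * a (suc j) ≡ (n C j) * a (suc j) + (n C suc j) * a (suc j)
  pascal j = trans (cong (_* a (suc j)) (sym (nCk+nC[k+1]≡[n+1]C[k+1] n j))) (*-distribʳ-+ (a (suc j)) (n C j) (n C suc j))
  unshifted : a 0 + sumBelow (suc n) (λ j → (n C suc j) * a (suc j)) ≡ sumBelow (suc n) (λ j → (n C j) * a j)
  unshifted = begin
    a 0 + sumBelow (suc n) (λ j → (n C suc j) * a (suc j))
      ≡⟨ cong (a 0 +_) (sumBelow-snoc n _) ⟩
    a 0 + (sumBelow n (λ j → (n C suc j) * a (suc j)) + (n C suc n) * a (suc n))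
      ≡⟨ cong (λ c → a 0 + (sumBelow n (λ j → (n C suc j) * a (suc j)) + c * a (suc n))) (k>n⇒nCk≡0 (n<1+n n)) ⟩
    a 0 + (sumBelow n (λ j → (n C suc j) * a (suc j)) + 0)
      ≡⟨ cong₂ _+_ (sym (*-identityˡ (a 0))) (+-identityʳ _) ⟩
    sumBelow (suc n) (λ j → (n C j) * a j) ∎

module PascalRecurrence (F : ℕ → ℕ → ℕ) (F-suc : ∀ a b → F (suc a) b ≡ F a b + F a (suc b)) where

  F[n+a]-binomial : ∀ n a b → F (n + a) b ≡ sumBelow (suc n) (λ j → (n C j) * F a (b + j))
  F[n+a]-binomial zero a b = sym (trans (+-identityʳ _) (trans (+-identityʳ _) (cong (F a) (+-identityʳ b))))
  F[n+a]-binomial (suc n) a b = begin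
    F (suc (n + a)) b
      ≡⟨ F-suc (n + a) b ⟩
    F (n + a) b + F (n + a) (suc b)
      ≡⟨ cong₂ _+_ (F[n+a]-binomial n a b) (F[n+a]-binomial n a (suc b)) ⟩
    sumBelow (suc n) (λ j → (n C j) * F a (b + j)) + sumBelow (suc n) (λ j → (n C j) * F a (suc b + j))
      ≡⟨ sym (sumBelow-+ (suc n) (λ j → (n C j) * F a (b + j)) (λ j → (n C j) * F a (suc b + j))) ⟩
    sumBelow (suc n) (λ j → (n C j) * F a (b + j) + (n C j) * F a (suc b + j))
      ≡⟨ sumBelow-cong (suc n) (λ j _ → trans (cong (λ c → (n C j) * F a (b + j) + (n C j) * F a c) (sym (+-suc b j)))
                                              (sym (*-distribˡ-+ (n C j) _ _))) ⟩
    sumBelow (suc n) (λ j → (n C j) * (F a (b + j) + F a (b + suc j)))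
      ≡⟨ sym (sumBelow-pascal n (λ j → F a (b + j))) ⟩
    sumBelow (suc (suc n)) (λ j → (suc n C j) * F a (b + j)) ∎
    where open ≡-Reasoning

  F[1+n]-binomial : (∀ b → F 1 b ≡ F b 0) →
    ∀ n b → F (suc n) b ≡ sumBelow (suc n) (λ j → (n C j) * F b j * 2 ^ (n ∸ j))
  F[1+n]-binomial F-1 zero b = trans (F-1 b) (sym (trans (+-identityʳ _) (trans (*-identityʳ _) (+-identityʳ _))))
  F[1+n]-binomial F-1 (suc n) b = begin
    F (suc (suc n)) b
      ≡⟨ F-suc (suc n) b ⟩
    F (suc n) b + F (suc n) (suc b)
      ≡⟨ cong₂ _+_ (F[1+n]-binomial F-1 n b) (F[1+n]-binomial F-1 n (suc b)) ⟩
    sumBelow (suc n) (λ j → (n C j) * F b j * 2 ^ (n ∸ j)) + sumBelow (suc n) (λ j → (n C j) * F (suc b) j * 2 ^ (n ∸ j))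
      ≡⟨ sym (sumBelow-+ (suc n) (λ j → (n C j) * F b j * 2 ^ (n ∸ j)) (λ j → (n C j) * F (suc b) j * 2 ^ (n ∸ j))) ⟩
    sumBelow (suc n) (λ j → (n C j) * F b j * 2 ^ (n ∸ j) + (n C j) * F (suc b) j * 2 ^ (n ∸ j))
      ≡⟨ sumBelow-cong (suc n) regroup ⟩
    sumBelow (suc n) (λ j → (n C j) * (w j + w (suc j)))
      ≡⟨ sym (sumBelow-pascal n w) ⟩
    sumBelow (suc (suc n)) (λ j → (suc n C j) * (F b j * 2 ^ (suc n ∸ j)))
      ≡⟨ sumBelow-cong (suc (suc n)) (λ j _ → sym (*-assoc (suc n C j) (F b j) (2 ^ (suc n ∸ j)))) ⟩
    sumBelow (suc (suc n)) (λ j → (suc n C j) * F b j * 2 ^ (suc n ∸ j)) ∎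
    where
    open ≡-Reasoning
    w : ℕ → ℕ
    w j = F b j * 2 ^ (suc n ∸ j)
    regroup : ∀ j → j < suc n →
      (n C j) * F b j * 2 ^ (n ∸ j) + (n C j) * F (suc b) j * 2 ^ (n ∸ j) ≡ (n C j) * (w j + w (suc j))
    regroup j (s≤s j≤n) rewrite +-∸-assoc 1 j≤n | F-suc b j = identity (n C j) (F b j) (F b (suc j)) (2 ^ (n ∸ j))
      where
      identity : ∀ c x y p → c * x * p + c * (x + y) * p ≡ c * (x * (2 * p) + y * p)
      identity = solve-∀

open PascalRecurrence A′ A′-suc

corollary3p7 : ∀ (n k : ℕ) →
    (Bell (n + k) ≡ sumTo n (λ j → (n C j) * A (k + j) k))
    × (A (n + k + 1) (n + 1) ≡ sumTo n (λ j → (n C j) * A (k + j) k * 2 ^ (n ∸ j)))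
corollary3p7 n k = Bell-expansion , A-expansion
  where
  open ≡-Reasoning
  Bell-expansion : Bell (n + k) ≡ sumTo n (λ j → (n C j) * A (k + j) k)
  Bell-expansion = begin
    Bell (n + k)
      ≡⟨ Bell≡restrictedBell (n + k) ⟩
    restrictedBell (n + k) (n + k)
      ≡⟨ cong (λ m → restrictedBell m (n + k)) (sym (+-identityʳ (n + k))) ⟩
    A′ (n + k) 0
      ≡⟨ F[n+a]-binomial n k 0 ⟩
    sumBelow (suc n) (λ j → (n C j) * A′ k j)
      ≡⟨ sumBelow-cong (suc n) (λ j _ → cong ((n C j) *_) (sym (A≡A′ k j))) ⟩
    sumBelow (suc n) (λ j → (n C j) * A (k + j) k)
      ≡⟨ sym (sumTo≡sumBelow n _) ⟩
    sumTo n (λ j → (n C j) * A (k + j) k) ∎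
  A-expansion : A (n + k + 1) (n + 1) ≡ sumTo n (λ j → (n C j) * A (k + j) k * 2 ^ (n ∸ j))
  A-expansion = begin
    A (n + k + 1) (n + 1)
      ≡⟨ cong₂ A (+-comm (n + k) 1) (+-comm n 1) ⟩
    A (suc n + k) (suc n)
      ≡⟨ A≡A′ (suc n) k ⟩
    A′ (suc n) k
      ≡⟨ F[1+n]-binomial A′-1 n k ⟩
    sumBelow (suc n) (λ j → (n C j) * A′ k j * 2 ^ (n ∸ j))
      ≡⟨ sumBelow-cong (suc n) (λ j _ → cong (λ x → (n C j) * x * 2 ^ (n ∸ j)) (sym (A≡A′ k j))) ⟩
    sumBelow (suc n) (λ j → (n C j) * A (k + j) k * 2 ^ (n ∸ j))
      ≡⟨ sym (sumTo≡sumBelow n _) ⟩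
    sumTo n (λ j → (n C j) * A (k + j) k * 2 ^ (n ∸ j)) ∎
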